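{- Every AT-free graph $G$ has slimness $sl(G)\le 1$.
   Context: All graphs are finite, connected, unweighted, undirected, without loops or multiple edges; $d_G$ is the shortest-path metric. A geodesic triangle $\triangle(x,y,z)$ is the union $P(x,y)\cup P(x,z)\cup P(y,z)$ of three shortest paths connecting $x,y,z$; it is $\delta$-slim if every vertex on any side is at distance at most $\delta$ from the union of the other two sides. The slimness $sl(G)$ is the smallest $\delta$ such that all geodesic triangles of $G$ are $\delta$-slim. An asteroidal triple is an independent set of three vertices such that each pair is joined by a path avoiding the closed neighborhood of the third; $G$ is AT-free if it has no asteroidal triple. -}

module Defs where

open import Data.Nat using (ℕ; zero; suc; _≤_)
open import Data.Fin using (Fin)
open import Data.Product using (Σ; ∃; _×_; _,_)
open import Data.Sum using (_⊎_)
open import Relation.Nullary using (¬_; Dec)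
open import Relation.Binary.PropositionalEquality using (_≡_)

record Graph : Set₁ where
  field
    n      : ℕ
    Adj    : Fin n → Fin n → Set
    adj?   : ∀ u v → Dec (Adj u v)
    sym    : ∀ {u v} → Adj u v → Adj v u
    irrefl : ∀ {u} → ¬ Adj u u

module _ (G : Graph) where
  open Graph G

  Vertex : Set
  Vertex = Fin n

  data Walk : Vertex → Vertex → ℕ → Set where
    [_]  : ∀ u → Walk u u zero
    _∷_  : ∀ {u w v k} → Adj u w → Walk w v k → Walk u v (suc k)

  data OnWalk (x : Vertex) : ∀ {u v k} → Walk u v k → Set where
    here-end : OnWalk x [ x ]
    here     : ∀ {w v k} (e : Adj x w) (p : Walk w v k) → OnWalk x (e ∷ p)
    there    : ∀ {u w v k} (e : Adj u w) {p : Walk w v k} →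
               OnWalk x p → OnWalk x (e ∷ p)

  Connected : Set
  Connected = ∀ u v → ∃ λ k → Walk u v k

  DistLe : Vertex → Vertex → ℕ → Set
  DistLe u v δ = ∃ λ k → k ≤ δ × Walk u v k

  IsShortest : ∀ {u v k} → Walk u v k → Set
  IsShortest {u} {v} {k} _ = ∀ m → Walk u v m → k ≤ m

  record ShortestPath (u v : Vertex) : Set where
    field
      len      : ℕ
      path     : Walk u v len
      shortest : IsShortest path

  On : ∀ {u v} → Vertex → ShortestPath u v → Set
  On w P = OnWalk w (ShortestPath.path P)

  CloseToUnion : ∀ {a b c d} → ℕ → Vertex → ShortestPath a b → ShortestPath c d → Set
  CloseToUnion δ w P Q = ∃ λ t → (On t P ⊎ On t Q) × DistLe w t δ

  TriangleSlim : ∀ {x y z} → ℕ →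
    ShortestPath x y → ShortestPath x z → ShortestPath y z → Set
  TriangleSlim δ Pxy Pxz Pyz =
      (∀ w → On w Pxy → CloseToUnion δ w Pxz Pyz)
    × (∀ w → On w Pxz → CloseToUnion δ w Pxy Pyz)
    × (∀ w → On w Pyz → CloseToUnion δ w Pxy Pxz)

  SlimnessLe : ℕ → Set
  SlimnessLe δ = ∀ x y z (Pxy : ShortestPath x y) (Pxz : ShortestPath x z)
                 (Pyz : ShortestPath y z) → TriangleSlim δ Pxy Pxz Pyz

  InClosedNbhd : Vertex → Vertex → Set
  InClosedNbhd z v = v ≡ z ⊎ Adj v z

  AvoidingWalk : Vertex → Vertex → Vertex → Set
  AvoidingWalk z u v = ∃ λ k → Σ (Walk u v k) λ p →
                         ∀ w → OnWalk w p → ¬ InClosedNbhd z w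

  IsAT : Vertex → Vertex → Vertex → Set
  IsAT x y z =
      ¬ x ≡ y × ¬ x ≡ z × ¬ y ≡ z
    × ¬ Adj x y × ¬ Adj x z × ¬ Adj y z
    × AvoidingWalk z x y × AvoidingWalk y x z × AvoidingWalk x y z

  ATFree : Set
  ATFree = ∀ x y z → ¬ IsAT x y z

-- If a vertex w of a geodesic from x to y had distance at least 2 from the
-- other two sides, those sides would form an x–y walk avoiding N[w]. Both
-- parts of the geodesic have length at least 2, so by minimality the part from
-- x to w avoids N[y] and the part from w to y avoids N[x]; hence x, y, w would
-- be an asteroidal triple.
module Submission where

open import Data.Fin using (_≟_)
open import Data.Nat using (ℕ; suc; _+_; _≤_; z≤n; s≤s)
open import Data.Nat.Properties
  using (≤-refl; ≤-trans; +-assoc; +-comm; +-monoʳ-≤; +-cancelˡ-≤; m≤n+m; 1+n≰n; module ≤-Reasoning)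
open import Data.Product using (∃; _×_; _,_)
open import Data.Sum using (_⊎_; inj₁; inj₂) renaming (map to ⊎-map)
open import Data.Empty using (⊥-elim)
open import Function using (id; _∘_)
open import Relation.Nullary using (¬_; Dec; yes; no)
open import Relation.Nullary.Decidable using (_⊎-dec_)
open import Relation.Binary.PropositionalEquality using (_≡_; refl; sym; trans; cong; subst)

open import Defs

module Walks (G : Graph) where
  open Graph G using (Adj; adj?) renaming (sym to adj-sym)

  private
    variable
      t u v w x y z : Vertex G
      a b k m : ℕ

  infixr 5 _++_
  infixl 5 _∷ʳ_

  _++_ : Walk G u v a → Walk G v w b → Walk G u w (a + b)
  [ _ ]   ++ q = q
  (e ∷ p) ++ q = e ∷ (p ++ q)

  onWalk-++⁻ : (p : Walk G u v a) (q : Walk G v w b) →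
               OnWalk G t (p ++ q) → OnWalk G t p ⊎ OnWalk G t q
  onWalk-++⁻ [ _ ]   q t∈q         = inj₂ t∈q
  onWalk-++⁻ (e ∷ p) q (here _ _)  = inj₁ (here e p)
  onWalk-++⁻ (e ∷ p) q (there _ t∈) = ⊎-map (there e) id (onWalk-++⁻ p q t∈)

  _∷ʳ_ : Walk G u v k → Adj v w → Walk G u w (suc k)
  [ _ ]    ∷ʳ e = e ∷ [ _ ]
  (e′ ∷ p) ∷ʳ e = e′ ∷ (p ∷ʳ e)

  onWalk-∷ʳ⁻ : (p : Walk G u v k) (e : Adj v w) →
               OnWalk G t (p ∷ʳ e) → OnWalk G t p ⊎ t ≡ w
  onWalk-∷ʳ⁻ [ _ ]    e (here _ _)         = inj₁ here-end
  onWalk-∷ʳ⁻ [ _ ]    e (there _ here-end) = inj₂ refl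
  onWalk-∷ʳ⁻ (e′ ∷ p) e (here _ _)         = inj₁ (here e′ p)
  onWalk-∷ʳ⁻ (e′ ∷ p) e (there _ t∈)       = ⊎-map (there e′) id (onWalk-∷ʳ⁻ p e t∈)

  reverse : Walk G u v k → Walk G v u k
  reverse [ u ]   = [ u ]
  reverse (e ∷ p) = reverse p ∷ʳ adj-sym e

  onWalk-reverse⁻ : (p : Walk G u v k) → OnWalk G t (reverse p) → OnWalk G t p
  onWalk-reverse⁻ [ _ ]   t∈ = t∈
  onWalk-reverse⁻ (e ∷ p) t∈ with onWalk-∷ʳ⁻ (reverse p) (adj-sym e) t∈
  ... | inj₁ t∈p  = there e (onWalk-reverse⁻ p t∈p)
  ... | inj₂ refl = here e p

  onWalk-start : (p : Walk G u v k) → OnWalk G u p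
  onWalk-start [ _ ]   = here-end
  onWalk-start (e ∷ p) = here e p

  onWalk-end : (p : Walk G u v k) → OnWalk G v p
  onWalk-end [ _ ]   = here-end
  onWalk-end (e ∷ p) = there e (onWalk-end p)

  record Split (u t v : Vertex G) (k : ℕ) : Set where
    constructor split
    field
      {prefixLen suffixLen} : ℕ
      prefix  : Walk G u t prefixLen
      suffix  : Walk G t v suffixLen
      lengths : prefixLen + suffixLen ≡ k

  splitAt : (p : Walk G u v k) → OnWalk G t p → Split u t v k
  splitAt [ _ ]   here-end    = split [ _ ] [ _ ] refl
  splitAt (e ∷ p) (here _ _)  = split [ _ ] (e ∷ p) refl
  splitAt (e ∷ p) (there _ t∈) with splitAt p t∈
  ... | split r s eq = split (e ∷ r) s (cong suc eq)

  DistGe : Vertex G → Vertex G → ℕ → Set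
  DistGe u v d = ∀ m → Walk G u v m → d ≤ m

  distGe-sym : ∀ {d} → DistGe u v d → DistGe v u d
  distGe-sym far m p = far m (reverse p)

  Avoids : Vertex G → Walk G u v k → Set
  Avoids z p = ∀ t → OnWalk G t p → ¬ InClosedNbhd G z t

  inClosedNbhd? : ∀ z v → Dec (InClosedNbhd G z v)
  inClosedNbhd? z v = (v ≟ z) ⊎-dec adj? v z

  meets-or-avoids : ∀ z (p : Walk G u v k) →
                    (∃ λ t → OnWalk G t p × InClosedNbhd G z t) ⊎ Avoids z p
  meets-or-avoids z [ u ] with inClosedNbhd? z u
  ... | yes u∈N = inj₁ (u , here-end , u∈N)
  ... | no  u∉N = inj₂ λ { _ here-end → u∉N }
  meets-or-avoids {u} z (e ∷ p) with inClosedNbhd? z u | meets-or-avoids z p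
  ... | yes u∈N | _                    = inj₁ (u , here e p , u∈N)
  ... | no  _   | inj₁ (t , t∈p , t∈N) = inj₁ (t , there e t∈p , t∈N)
  ... | no  u∉N | inj₂ p-avoids        =
    inj₂ λ { _ (here _ _) → u∉N ; t (there _ t∈p) → p-avoids t t∈p }

  closedNbhd⇒dist≤1 : InClosedNbhd G z t → DistLe G z t 1
  closedNbhd⇒dist≤1 (inj₁ refl) = 0 , z≤n , [ _ ]
  closedNbhd⇒dist≤1 (inj₂ t~z)  = 1 , ≤-refl , adj-sym t~z ∷ [ _ ]

  ∉closedNbhd⇒2≤length : ¬ InClosedNbhd G v u → Walk G u v k → 2 ≤ k
  ∉closedNbhd⇒2≤length u∉N [ _ ]            = ⊥-elim (u∉N (inj₁ refl))
  ∉closedNbhd⇒2≤length u∉N (e ∷ [ _ ])      = ⊥-elim (u∉N (inj₂ e))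
  ∉closedNbhd⇒2≤length u∉N (_ ∷ (_ ∷ _))    = s≤s (s≤s z≤n)

  short-walk-avoids-closedNbhd : DistGe x y (a + b) → 2 ≤ b →
                                 (p : Walk G x w a) → Avoids y p
  short-walk-avoids-closedNbhd {a = a} {b} far 2≤b p t t∈p t∈N[y]
    with splitAt p t∈p | closedNbhd⇒dist≤1 t∈N[y]
  ... | split {a₁} {a₂} r _ a₁+a₂≡a | ℓ , ℓ≤1 , s =
    1+n≰n (+-cancelˡ-≤ a₁ 2 1 (begin
      a₁ + 2         ≤⟨ +-monoʳ-≤ a₁ (≤-trans 2≤b (m≤n+m b a₂)) ⟩
      a₁ + (a₂ + b)  ≡⟨ sym (+-assoc a₁ a₂ b) ⟩
      a₁ + a₂ + b    ≡⟨ cong (_+ b) a₁+a₂≡a ⟩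
      a + b          ≤⟨ far (a₁ + ℓ) (r ++ reverse s) ⟩
      a₁ + ℓ         ≤⟨ +-monoʳ-≤ a₁ ℓ≤1 ⟩
      a₁ + 1         ∎))
    where open ≤-Reasoning

  walk-meets-closedNbhd-of-geodesic :
    ATFree G → (p : Walk G x y k) → IsShortest G p → (q : Walk G x y m) →
    ∀ w → OnWalk G w p → ∃ λ t → OnWalk G t q × InClosedNbhd G w t
  walk-meets-closedNbhd-of-geodesic {x} {y} at p p-short q w w∈p
    with meets-or-avoids w q
  ... | inj₁ meet     = meet
  ... | inj₂ q-avoids =
    ⊥-elim (at x y w ( x∉N[y] ∘ inj₁ , x∉N[w] ∘ inj₁ , y∉N[w] ∘ inj₁
                     , x∉N[y] ∘ inj₂ , x∉N[w] ∘ inj₂ , y∉N[w] ∘ inj₂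
                     , (_ , q , q-avoids)
                     , (_ , prefix , prefix-avoids)
                     , (_ , reverse suffix , suffix-avoids) ))
    where
      open Split (splitAt p w∈p)
      x∉N[w] : ¬ InClosedNbhd G w x
      x∉N[w] = q-avoids x (onWalk-start q)
      y∉N[w] : ¬ InClosedNbhd G w y
      y∉N[w] = q-avoids y (onWalk-end q)
      prefix-avoids : Avoids y prefix
      prefix-avoids = short-walk-avoids-closedNbhd
        (subst (DistGe x y) (sym lengths) p-short)
        (∉closedNbhd⇒2≤length y∉N[w] (reverse suffix)) prefix
      suffix-avoids : Avoids x (reverse suffix)
      suffix-avoids = short-walk-avoids-closedNbhd
        (subst (DistGe y x) (trans (sym lengths) (+-comm prefixLen suffixLen))
               (distGe-sym p-short))
        (∉closedNbhd⇒2≤length x∉N[w] prefix) (reverse suffix)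
      x∉N[y] : ¬ InClosedNbhd G y x
      x∉N[y] = prefix-avoids x (onWalk-start prefix)

  geodesic-side-slim :
    ATFree G → (P : ShortestPath G u v)
    (Q : ShortestPath G x y) (R : ShortestPath G z w) (q : Walk G u v m) →
    (∀ t → OnWalk G t q → On G t Q ⊎ On G t R) →
    ∀ s → On G s P → CloseToUnion G 1 s Q R
  geodesic-side-slim at P Q R q q⊆Q∪R s s∈P
    with walk-meets-closedNbhd-of-geodesic at (path P) (shortest P) q s s∈P
    where open ShortestPath
  ... | t , t∈q , t∈N[s] = t , q⊆Q∪R t t∈q , closedNbhd⇒dist≤1 t∈N[s]

proposition3 : (G : Graph) → Connected G → ATFree G → SlimnessLe G 1
proposition3 G _ at x y z Pxy Pxz Pyz =
    geodesic-side-slim at Pxy Pxz Pyz (path Pxz ++ reverse (path Pyz))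
      (λ _ → ⊎-map id (onWalk-reverse⁻ (path Pyz)) ∘ onWalk-++⁻ (path Pxz) _)
  , geodesic-side-slim at Pxz Pxy Pyz (path Pxy ++ path Pyz)
      (λ _ → onWalk-++⁻ (path Pxy) (path Pyz))
  , geodesic-side-slim at Pyz Pxy Pxz (reverse (path Pxy) ++ path Pxz)
      (λ _ → ⊎-map (onWalk-reverse⁻ (path Pxy)) id ∘ onWalk-++⁻ _ (path Pxz))
  where
    open Walks G
    open ShortestPath
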